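{- Let $\Gamma$ be a simple graph, $\delta(v)$ the degree of a vertex $v$ in $\Gamma$, and ${\cal L}(\Gamma)$ its line graph. Then: (1) $a({\cal L}(\Gamma))=1$ if and only if either $\Gamma$ has a connected component isomorphic to $K_2$, or $\Gamma$ has a vertex of degree one which is adjacent to a vertex of degree two. (2) $a({\cal L}(\Gamma))=2$ if and only if $a({\cal L}(\Gamma))\ne 1$ and $\Gamma$ has a subgraph isomorphic to $P_3$, with vertices, in order, $u,v,w$, such that $\delta(u)+\delta(v)\le 5$ and $\delta(v)+\delta(w)\le 5$. (3) $a({\cal L}(\Gamma))=3$ if and only if $a({\cal L}(\Gamma))\ne1$, $a({\cal L}(\Gamma))\ne 2$, and $\Gamma$ has a subgraph isomorphic to either (a) $P_4$, with vertices, in order, $u,v,w,x$, such that $\delta(u)+\delta(v)\le5$, $\delta(x)+\delta(w)\le 5$ and $\delta(v)+\delta(w)\le 7$; or (b) $K_3$, with vertices $u,v,w$, such that $\delta(u)+\delta(v)\le7$, $\delta(u)+\delta(w)\le 7$ and $\delta(v)+\delta(w)\le7$; or (c) $K_{1,3}$ with vertices $u,v,w,x$ and hub $v$, such that $\delta(v)+\delta(u)\le 7$, $\delta(v)+\delta(w)\le7$ and $\delta(v)+\delta(x)\le 7$.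
   Context: For a graph $G=(V,E)$, a set $S\subseteq V$ and a vertex $v$, let $N_S(v)$ be the set of neighbours of $v$ in $S$ and $N_{V\setminus S}(v)$ the set of neighbours of $v$ in $V\setminus S$. A nonempty set $S\subseteq V$ is a defensive alliance if $|N_S(v)|+1\ge |N_{V\setminus S}(v)|$ for every $v\in S$. The defensive alliance number $a(G)$ is the minimum cardinality of a defensive alliance in $G$. The line graph ${\cal L}(\Gamma)$ has the edges of $\Gamma$ as vertices, two being adjacent when they share an endpoint. "Subgraph" means a (not necessarily induced) subgraph; degrees $\delta(\cdot)$ are taken in $\Gamma$. -}

module Defs where

open import Data.Nat using (ℕ; zero; suc; _+_; _≤_; _<_)
open import Data.Bool using (Bool; true; false; if_then_else_; _∧_; _∨_; not)
open import Data.Fin using (Fin; toℕ)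
import Data.Fin as F
open import Data.List using (List; []; _∷_; length; lookup; concatMap; allFin)
open import Data.Product using (_×_; _,_; Σ; ∃; ∃-syntax; proj₁; proj₂)
open import Relation.Binary.PropositionalEquality using (_≡_)
open import Relation.Nullary.Decidable using (⌊_⌋)
open import Data.Nat using (_<?_)

record Graph : Set where
  field
    n      : ℕ
    adj    : Fin n → Fin n → Bool
    sym    : ∀ i j → adj i j ≡ adj j i
    irrefl : ∀ i → adj i i ≡ false
open Graph public

count : {m : ℕ} → (Fin m → Bool) → ℕ
count {zero}  p = 0
count {suc m} p = (if p F.zero then 1 else 0) + count (λ i → p (F.suc i))

nIn : {m : ℕ} → (Fin m → Fin m → Bool) → (Fin m → Bool) → Fin m → ℕ
nIn A S v = count (λ u → A v u ∧ S u)

nOut : {m : ℕ} → (Fin m → Fin m → Bool) → (Fin m → Bool) → Fin m → ℕ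
nOut A S v = count (λ u → A v u ∧ not (S u))

DefensiveAlliance : {m : ℕ} → (Fin m → Fin m → Bool) → (Fin m → Bool) → Set
DefensiveAlliance A S =
  (1 ≤ count S) × (∀ v → S v ≡ true → nOut A S v ≤ nIn A S v + 1)

AllianceNumberIs : {m : ℕ} → (Fin m → Fin m → Bool) → ℕ → Set
AllianceNumberIs A k =
  (∃[ S ] (DefensiveAlliance A S × count S ≡ k)) ×
  (∀ S → DefensiveAlliance A S → k ≤ count S)

-- Line graph: vertices are the edges {i,j} (listed once, as (i,j) with i<j).

module _ (G : Graph) where
  private
    V = Fin (n G)

  edges : List (V × V)
  edges = concatMap (λ i → concatMap (λ j →
            if ⌊ toℕ i <? toℕ j ⌋ ∧ adj G i j then (i , j) ∷ [] else [])
            (allFin (n G))) (allFin (n G))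

  nL : ℕ
  nL = length edges

  edgeAt : Fin nL → V × V
  edgeAt k = lookup edges k

  private
    eqV : V → V → Bool
    eqV a b = ⌊ a F.≟ b ⌋

  lineAdj : Fin nL → Fin nL → Bool
  lineAdj k l with edgeAt k | edgeAt l
  ... | (a , b) | (c , d) =
    not ⌊ k F.≟ l ⌋ ∧ (eqV a c ∨ eqV a d ∨ eqV b c ∨ eqV b d)

  aL≡ : ℕ → Set
  aL≡ k = AllianceNumberIs lineAdj k

  deg : V → ℕ
  deg v = count (adj G v)

  E : V → V → Set
  E u v = adj G u v ≡ true

  -- a connected component isomorphic to K₂: an edge uv with no further
  -- edges at u or v
  HasK2Component : Set
  HasK2Component = ∃[ u ] ∃[ v ] (E u v × deg u ≡ 1 × deg v ≡ 1)

  DegOneNextToDegTwo : Set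
  DegOneNextToDegTwo = ∃[ u ] ∃[ v ] (E u v × deg u ≡ 1 × deg v ≡ 2)

{-# OPTIONS --safe #-}
module Submission where

-- A vertex v of S with s neighbours in S satisfies the alliance inequality iff
-- deg v ≤ 2s + 1.  Hence a(H) = 1 iff H has a vertex of degree ≤ 1; when it has
-- none, every member of a small alliance needs a neighbour in it, so an alliance
-- on two vertices is an edge with end degrees ≤ 3, and one on three vertices is a
-- path (ends ≤ 3, middle ≤ 5) or a triangle (all ≤ 5).  In L(Γ) the vertex uv has
-- degree δ(u) + δ(v) − 2, an edge of L(Γ) is a P₃ of Γ, an induced path on three
-- vertices of L(Γ) is a P₄ of Γ, and a triangle of L(Γ) is a K₃ or a K₁,₃ of Γ.

open import Defs hiding (sym)
open import Data.Nat using (ℕ; zero; suc; _+_; _≤_; _<_; z≤n; s≤s; _<?_)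
open import Data.Nat.Properties
  using (+-suc; +-identityʳ; +-comm; ≤-antisym; ≤-reflexive; ≤-trans; m≤n⇒m<n∨m≡n; <-cmp; <-asym;
         +-monoʳ-≤; +-monoˡ-≤; +-cancelˡ-≤; +-cancelʳ-≤; module ≤-Reasoning)
  renaming (suc-injective to suc-injective′)
open import Data.Bool using (Bool; true; false; if_then_else_; _∧_; _∨_; not; T)
open import Data.Bool.Properties using (∧-identityʳ; ∧-zeroʳ; ∨-zeroʳ; ∧-distribˡ-∨; ∧-comm; ∨-assoc; T-∧; T-≡; ¬-not)
open import Data.Fin using (Fin; zero; suc; _≟_; toℕ)
open import Data.Fin.Properties using (suc-injective; toℕ-injective)
open import Data.Vec using (Vec; []; _∷_; map; sum)
open import Data.Vec.Membership.Propositional using (_∈_)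
open import Data.Vec.Relation.Unary.Any using (here; there)
open import Data.Vec.Relation.Unary.All using (All; []; _∷_)
open import Data.Vec.Relation.Unary.AllPairs using ([]; _∷_)
open import Data.Vec.Relation.Unary.Unique.Propositional using (Unique)
open import Data.List as List using (List; filter; cartesianProduct; allFin; concatMap; _++_)
open import Data.List.Properties using (filter-++)
open import Data.List.Membership.Propositional using () renaming (_∈_ to _∈ₗ_)
open import Data.List.Membership.Propositional.Properties
  using (∈-filter⁺; ∈-filter⁻; ∈-cartesianProduct⁺; ∈-allFin; ∈-lookup)
import Data.List.Relation.Unary.All as ListAll
import Data.List.Relation.Unary.Any as ListAny
open import Data.List.Relation.Unary.Any.Properties using (lookup-index)
open import Data.List.Relation.Unary.AllPairs using ([]; _∷_)
import Data.List.Relation.Unary.Unique.Propositional as ListUnique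
import Data.List.Relation.Unary.Unique.Propositional.Properties as ListUnique
open import Data.Empty using (⊥-elim)
open import Data.Product using (_×_; _,_; ∃-syntax; proj₁; proj₂)
open import Data.Sum using (_⊎_; inj₁; inj₂; swap)
open import Function using (_∘_)
open import Relation.Nullary using (¬_; yes; no)
open import Relation.Nullary.Decidable using (⌊_⌋; ⌊⌋-map′; T?; toWitness; fromWitness)
open import Relation.Binary using (tri<; tri≈; tri>)
open import Relation.Binary.PropositionalEquality
open import Function.Bundles using (_⇔_; mk⇔; Equivalence)
import Function.Properties.Equivalence as ⇔
open import Data.Product.Function.NonDependent.Propositional using (_×-⇔_)
open import Data.Sum.Function.Propositional using (_⊎-⇔_)

-- Counting subsets of Fin m

⟦_⟧ : Bool → ℕ
⟦ b ⟧ = if b then 1 else 0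

∧-true⁻ : ∀ {a b} → a ∧ b ≡ true → a ≡ true × b ≡ true
∧-true⁻ {true} b≡true = refl , b≡true

∨-true⁻ : ∀ {a b} → a ∨ b ≡ true → a ≡ true ⊎ b ≡ true
∨-true⁻ {true}  _      = inj₁ refl
∨-true⁻ {false} b≡true = inj₂ b≡true

module _ {m : ℕ} where

  ∅ : Fin m → Bool
  ∅ _ = false

  ⁅_⁆ : Fin m → Fin m → Bool
  ⁅ x ⁆ i = ⌊ x ≟ i ⌋

  ∁ : (Fin m → Bool) → Fin m → Bool
  ∁ p i = not (p i)

  infixr 6 _∩_
  infixr 5 _∪_
  infixl 5 _─_

  _∪_ _∩_ : (Fin m → Bool) → (Fin m → Bool) → Fin m → Bool
  (p ∪ q) i = p i ∨ q i
  (p ∩ q) i = p i ∧ q i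

  _─_ : (Fin m → Bool) → Fin m → Fin m → Bool
  p ─ x = p ∩ ∁ ⁅ x ⁆

⁅⁆-refl : ∀ {m} (x : Fin m) → ⁅ x ⁆ x ≡ true
⁅⁆-refl x with x ≟ x
... | yes _   = refl
... | no x≢x = ⊥-elim (x≢x refl)

⁅⁆-true⁻ : ∀ {m} {x i : Fin m} → ⁅ x ⁆ i ≡ true → x ≡ i
⁅⁆-true⁻ {x = x} {i} hit with x ≟ i
... | yes x≡i = x≡i

⁅⁆-false : ∀ {m} {x i : Fin m} → x ≢ i → ⁅ x ⁆ i ≡ false
⁅⁆-false {x = x} {i} x≢i with x ≟ i
... | yes x≡i = ⊥-elim (x≢i x≡i)
... | no _    = refl

count-cong : ∀ {m} {p q : Fin m → Bool} → p ≗ q → count p ≡ count q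
count-cong {zero}  p≗q = refl
count-cong {suc m} p≗q = cong₂ _+_ (cong ⟦_⟧ (p≗q zero)) (count-cong (p≗q ∘ suc))

count-none : ∀ {m} {p : Fin m → Bool} → (∀ i → p i ≡ false) → count p ≡ 0
count-none {zero}  none = refl
count-none {suc m} none rewrite none zero = count-none (none ∘ suc)

count≡0⇒none : ∀ {m} {p : Fin m → Bool} → count p ≡ 0 → ∀ i → p i ≡ false
count≡0⇒none {suc m} {p} c i with p zero in e
count≡0⇒none {suc m} {p} () i       | true
count≡0⇒none {suc m} {p} c zero    | false = e
count≡0⇒none {suc m} {p} c (suc i) | false = count≡0⇒none c i

count-witness : ∀ {m} {p : Fin m → Bool} {c} → count p ≡ suc c → ∃[ x ] p x ≡ true
count-witness {suc m} {p} c with p zero in e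
... | true  = zero , e
... | false = let x , px = count-witness c in suc x , px

count-partition : ∀ {m} (p r : Fin m → Bool) → count p ≡ count (p ∩ r) + count (p ∩ ∁ r)
count-partition {zero}  p r = refl
count-partition {suc m} p r with p zero | r zero | count-partition (p ∘ suc) (r ∘ suc)
... | true  | true  | ih = cong suc ih
... | true  | false | ih = trans (cong suc ih) (sym (+-suc _ _))
... | false | _     | ih = ih

count-∪-∩ : ∀ {m} (p q : Fin m → Bool) → count (p ∪ q) + count (p ∩ q) ≡ count p + count q
count-∪-∩ {zero}  p q = refl
count-∪-∩ {suc m} p q with p zero | q zero | count-∪-∩ (p ∘ suc) (q ∘ suc)
... | true  | true  | ih = cong suc (trans (+-suc _ _) (trans (cong suc ih) (sym (+-suc _ _))))
... | true  | false | ih = cong suc ih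
... | false | true  | ih = trans (cong suc ih) (sym (+-suc _ _))
... | false | false | ih = ih

count-∪-disjoint : ∀ {m} (p q : Fin m → Bool) → (∀ i → (p ∩ q) i ≡ false) →
                   count (p ∪ q) ≡ count p + count q
count-∪-disjoint p q disjoint = begin
  count (p ∪ q)                     ≡⟨ +-identityʳ _ ⟨
  count (p ∪ q) + 0                 ≡⟨ cong (count (p ∪ q) +_) (count-none disjoint) ⟨
  count (p ∪ q) + count (p ∩ q)     ≡⟨ count-∪-∩ p q ⟩
  count p + count q                 ∎
  where open ≡-Reasoning

count-∩⁅⁆ : ∀ {m} (p : Fin m → Bool) (x : Fin m) → count (p ∩ ⁅ x ⁆) ≡ ⟦ p x ⟧
count-∩⁅⁆ p zero rewrite ∧-identityʳ (p zero) =
  trans (cong (⟦ p zero ⟧ +_) (count-none (λ i → ∧-zeroʳ (p (suc i))))) (+-identityʳ _)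
count-∩⁅⁆ p (suc x) rewrite ∧-zeroʳ (p zero) =
  trans (count-cong (λ i → cong (p (suc i) ∧_) (⌊⌋-map′ _ _ (x ≟ i)))) (count-∩⁅⁆ (λ i → p (suc i)) x)

count-⁅⁆ : ∀ {m} (x : Fin m) → count ⁅ x ⁆ ≡ 1
count-⁅⁆ = count-∩⁅⁆ (λ _ → true)

count-singleton : ∀ {m} {p : Fin m → Bool} {x} → p x ≡ true → (∀ i → p i ≡ true → i ≡ x) → count p ≡ 1
count-singleton {p = p} {x} px only = trans (count-cong agree) (count-⁅⁆ x)
  where
  agree : p ≗ ⁅ x ⁆
  agree i with x ≟ i
  ... | yes refl = px
  ... | no x≢i   = ¬-not (λ pi → x≢i (sym (only i pi)))

count-remove : ∀ {m} {p : Fin m → Bool} {x} → p x ≡ true → count p ≡ suc (count (p ─ x))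
count-remove {p = p} {x} px = begin
  count p                              ≡⟨ count-partition p ⁅ x ⁆ ⟩
  count (p ∩ ⁅ x ⁆) + count (p ─ x)    ≡⟨ cong (_+ count (p ─ x)) (count-∩⁅⁆ p x) ⟩
  ⟦ p x ⟧ + count (p ─ x)              ≡⟨ cong (λ b → ⟦ b ⟧ + count (p ─ x)) px ⟩
  suc (count (p ─ x))                  ∎
  where open ≡-Reasoning

count-≤-injection : ∀ {m m′} {p : Fin m → Bool} {q : Fin m′ → Bool} (f : ∀ i → p i ≡ true → Fin m′) →
                    (∀ i pi → q (f i pi) ≡ true) → (∀ i j pi pj → f i pi ≡ f j pj → i ≡ j) →
                    count p ≤ count q
count-≤-injection {zero} f into inj = z≤n
count-≤-injection {suc m} {p = p} {q} f into inj with p zero in e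
... | false = count-≤-injection (f ∘ suc) (into ∘ suc) (λ i j pi pj → suc-injective ∘ inj _ _ pi pj)
... | true  = begin
  suc (count (p ∘ suc))        ≤⟨ s≤s (count-≤-injection (f ∘ suc) into′ (λ i j pi pj → suc-injective ∘ inj _ _ pi pj)) ⟩
  suc (count (q ─ f zero e))   ≡⟨ count-remove {p = q} (into zero e) ⟨
  count q                      ∎
  where
  open ≤-Reasoning
  into′ : ∀ i pi → (q ─ f zero e) (f (suc i) pi) ≡ true
  into′ i pi with f zero e ≟ f (suc i) pi
  ... | yes same with () ← inj _ _ e pi same
  ... | no _ rewrite into (suc i) pi = refl

toSet : ∀ {m c} → Vec (Fin m) c → Fin m → Bool
toSet []       = ∅
toSet (x ∷ xs) = ⁅ x ⁆ ∪ toSet xs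

module _ {m : ℕ} where

  toSet-∈ : ∀ {c v} {xs : Vec (Fin m) c} → v ∈ xs → toSet xs v ≡ true
  toSet-∈ {v = v} {_ ∷ xs} (here refl)  = cong (_∨ toSet xs v) (⁅⁆-refl v)
  toSet-∈ {v = v} {x ∷ _}  (there v∈xs) = trans (cong (⁅ x ⁆ v ∨_) (toSet-∈ v∈xs)) (∨-zeroʳ _)

  ∈-toSet : ∀ {c v} {xs : Vec (Fin m) c} → toSet xs v ≡ true → v ∈ xs
  ∈-toSet {v = v} {x ∷ xs} v∈ with x ≟ v
  ... | yes refl = here refl
  ... | no _     = there (∈-toSet v∈)

  toSet-false : ∀ {c v} {xs : Vec (Fin m) c} → All (v ≢_) xs → toSet xs v ≡ false
  toSet-false [] = refl
  toSet-false {v = v} {x ∷ xs} (v≢x ∷ v∉xs) with x ≟ v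
  ... | yes refl = ⊥-elim (v≢x refl)
  ... | no _     = toSet-false v∉xs

  toSet-false⁻ : ∀ {c v} {xs : Vec (Fin m) c} → toSet xs v ≡ false → All (v ≢_) xs
  toSet-false⁻ {xs = []} _ = []
  toSet-false⁻ {v = v} {x ∷ xs} v∉ with x ≟ v
  ... | no x≢v = (x≢v ∘ sym) ∷ toSet-false⁻ v∉

  count-∩-toSet : ∀ {c} (p : Fin m → Bool) {xs : Vec (Fin m) c} → Unique xs →
                  count (p ∩ toSet xs) ≡ sum (map (⟦_⟧ ∘ p) xs)
  count-∩-toSet p [] = count-none (λ i → ∧-zeroʳ (p i))
  count-∩-toSet p {x ∷ xs} (x∉xs ∷ unique) = begin
    count (p ∩ (⁅ x ⁆ ∪ toSet xs))                ≡⟨ count-cong (λ i → ∧-distribˡ-∨ (p i) _ _) ⟩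
    count ((p ∩ ⁅ x ⁆) ∪ (p ∩ toSet xs))          ≡⟨ count-∪-disjoint (p ∩ ⁅ x ⁆) (p ∩ toSet xs) disjoint ⟩
    count (p ∩ ⁅ x ⁆) + count (p ∩ toSet xs)      ≡⟨ cong₂ _+_ (count-∩⁅⁆ p x) (count-∩-toSet p unique) ⟩
    ⟦ p x ⟧ + sum (map (⟦_⟧ ∘ p) xs)              ∎
    where
    open ≡-Reasoning
    disjoint : ∀ i → ((p ∩ ⁅ x ⁆) ∩ (p ∩ toSet xs)) i ≡ false
    disjoint i with p i | x ≟ i
    ... | false | _        = refl
    ... | true  | no _     = refl
    ... | true  | yes refl = toSet-false x∉xs

  count-toSet : ∀ {c} {xs : Vec (Fin m) c} → Unique xs → count (toSet xs) ≡ c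
  count-toSet {xs = xs} unique = trans (count-∩-toSet (λ _ → true) unique) (sum-ones xs)
    where
    sum-ones : ∀ {c} (xs : Vec (Fin m) c) → sum (map (λ _ → 1) xs) ≡ c
    sum-ones []       = refl
    sum-ones (_ ∷ xs) = cong suc (sum-ones xs)

  toSet-complete : ∀ {c} {S : Fin m → Bool} → count S ≡ c → ∃[ xs ] (Unique {n = c} xs × S ≗ toSet xs)
  toSet-complete {zero}  |S|≡0 = [] , [] , count≡0⇒none |S|≡0
  toSet-complete {suc c} {S} |S|≡1+c with count-witness |S|≡1+c
  ... | x , Sx with toSet-complete {S = S ─ x} (suc-injective′ (trans (sym (count-remove {p = S} Sx)) |S|≡1+c))
  ... | xs , unique , S─x≗xs = x ∷ xs , toSet-false⁻ x∉xs ∷ unique , S≗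
    where
    x∉xs : toSet xs x ≡ false
    x∉xs = trans (sym (S─x≗xs x)) (trans (cong (λ b → S x ∧ not b) (⁅⁆-refl x)) (∧-zeroʳ (S x)))
    S≗ : S ≗ toSet (x ∷ xs)
    S≗ i with x ≟ i | S─x≗xs i
    ... | yes refl | _         = Sx
    ... | no _     | S─x≡xs[i] = trans (sym (∧-identityʳ (S i))) S─x≡xs[i]

-- Small defensive alliances

module _ {m : ℕ} (A : Fin m → Fin m → Bool) where

  allianceNumber-unique : ∀ {k j} → AllianceNumberIs A k → AllianceNumberIs A j → k ≡ j
  allianceNumber-unique ((S , daS , |S|≡k) , k-min) ((T , daT , |T|≡j) , j-min) =
    ≤-antisym (subst (_ ≤_) |T|≡j (k-min T daT)) (subst (_ ≤_) |S|≡k (j-min S daS))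

  allianceNumber-≢ : ∀ {k j} → AllianceNumberIs A k → k ≢ j → ¬ AllianceNumberIs A j
  allianceNumber-≢ a≡k k≢j a≡j = k≢j (allianceNumber-unique a≡k a≡j)

  alliance-size≥1 : ∀ S → DefensiveAlliance A S → 1 ≤ count S
  alliance-size≥1 _ = proj₁

  alliance-size-step : ∀ {k} → (∀ S → DefensiveAlliance A S → k ≤ count S) → ¬ AllianceNumberIs A k →
                       ∀ S → DefensiveAlliance A S → suc k ≤ count S
  alliance-size-step k-min ¬a≡k S daS with m≤n⇒m<n∨m≡n (k-min S daS)
  ... | inj₁ k<|S| = k<|S|
  ... | inj₂ k≡|S| = ⊥-elim (¬a≡k ((S , daS , sym k≡|S|) , k-min))

module _ (H : Graph) where
  private
    V = Fin (n H)
    A = adj H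

  DefensiveVertex : Set
  DefensiveVertex = ∃[ k ] deg H k ≤ 1

  DefensiveEdge : Set
  DefensiveEdge = ∃[ k ] ∃[ l ] (E H k l × deg H k ≤ 3 × deg H l ≤ 3)

  DefensivePath : Set
  DefensivePath = ∃[ k ] ∃[ l ] ∃[ m ] (k ≢ m × E H k l × E H l m × adj H k m ≡ false
                    × deg H k ≤ 3 × deg H l ≤ 5 × deg H m ≤ 3)

  DefensiveTriangle : Set
  DefensiveTriangle = ∃[ k ] ∃[ l ] ∃[ m ] (E H k l × E H l m × E H k m
                        × deg H k ≤ 5 × deg H l ≤ 5 × deg H m ≤ 5)

  E⇒≢ : ∀ {u v} → E H u v → u ≢ v
  E⇒≢ {u} uv refl with () ← trans (sym uv) (irrefl H u)

  E⇒1≤deg : ∀ {u v} → E H u v → 1 ≤ deg H u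
  E⇒1≤deg {u} uv = subst (1 ≤_) (sym (count-remove {p = adj H u} uv)) (s≤s z≤n)

  _DefendedBy_ : V → ℕ → Set
  v DefendedBy s = deg H v ≤ s + (s + 1)

  defended⇔ : ∀ S v → nOut A S v ≤ nIn A S v + 1 ⇔ v DefendedBy nIn A S v
  defended⇔ S v = mk⇔ (λ out≤ → subst (_≤ i + (i + 1)) (sym split) (+-monoʳ-≤ i out≤))
                      (λ deg≤ → +-cancelˡ-≤ i _ _ (subst (_≤ i + (i + 1)) split deg≤))
    where
    i = nIn A S v
    split : deg H v ≡ i + nOut A S v
    split = count-partition (A v) S

  neighboursIn : ∀ {c} → Vec V c → V → ℕ
  neighboursIn xs v = sum (map (⟦_⟧ ∘ A v) xs)

  alliance⇔defended : ∀ {c x S} {xs : Vec V c} → S ≗ toSet (x ∷ xs) → Unique (x ∷ xs) →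
                      DefensiveAlliance A S ⇔ (∀ {v} → v ∈ x ∷ xs → v DefendedBy neighboursIn (x ∷ xs) v)
  alliance⇔defended {x = x} {S} {xs} S≗ unique = mk⇔ to from
    where
    nIn≡ : ∀ v → nIn A S v ≡ neighboursIn (x ∷ xs) v
    nIn≡ v = trans (count-cong (λ u → cong (A v u ∧_) (S≗ u))) (count-∩-toSet (A v) unique)
    to : DefensiveAlliance A S → ∀ {v} → v ∈ x ∷ xs → v DefendedBy neighboursIn (x ∷ xs) v
    to (_ , safe) {v} v∈ =
      subst (v DefendedBy_) (nIn≡ v) (Equivalence.to (defended⇔ S v) (safe v (trans (S≗ v) (toSet-∈ v∈))))
    from : (∀ {v} → v ∈ x ∷ xs → v DefendedBy neighboursIn (x ∷ xs) v) → DefensiveAlliance A S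
    from defended = nonempty , λ v Sv →
      Equivalence.from (defended⇔ S v) (subst (v DefendedBy_) (sym (nIn≡ v)) (defended (∈-toSet (trans (sym (S≗ v)) Sv))))
      where
      nonempty : 1 ≤ count S
      nonempty = subst (1 ≤_) (sym (count-remove {p = S} (trans (S≗ x) (toSet-∈ {xs = x ∷ xs} (here refl))))) (s≤s z≤n)

  toSet-allianceNumber : ∀ {c x} {xs : Vec V c} → Unique (x ∷ xs) →
                         (∀ {v} → v ∈ x ∷ xs → v DefendedBy neighboursIn (x ∷ xs) v) →
                         (∀ S → DefensiveAlliance A S → suc c ≤ count S) → AllianceNumberIs A (suc c)
  toSet-allianceNumber {x = x} {xs} unique defended minimal =
    (toSet (x ∷ xs) , Equivalence.from (alliance⇔defended (λ _ → refl) unique) defended , count-toSet unique) , minimal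

  singleton-neighbours : ∀ x → neighboursIn (x ∷ []) x ≡ 0
  singleton-neighbours x rewrite irrefl H x = refl

  pair-neighbours : ∀ x y → neighboursIn (x ∷ y ∷ []) x ≡ ⟦ A x y ⟧ × neighboursIn (x ∷ y ∷ []) y ≡ ⟦ A x y ⟧
  pair-neighbours x y rewrite irrefl H x | irrefl H y | Graph.sym H y x = +-identityʳ _ , +-identityʳ _

  triad-neighbours : ∀ x y z → let t = x ∷ y ∷ z ∷ [] in
                       neighboursIn t x ≡ ⟦ A x y ⟧ + ⟦ A x z ⟧
                     × neighboursIn t y ≡ ⟦ A x y ⟧ + ⟦ A y z ⟧
                     × neighboursIn t z ≡ ⟦ A x z ⟧ + ⟦ A y z ⟧
  triad-neighbours x y z
    rewrite irrefl H x | irrefl H y | irrefl H z | Graph.sym H y x | Graph.sym H z x | Graph.sym H z y =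
      cong (⟦ A x y ⟧ +_) (+-identityʳ _) , cong (⟦ A x y ⟧ +_) (+-identityʳ _) , cong (⟦ A x z ⟧ +_) (+-identityʳ _)

  allianceNumber≡1⇔ : AllianceNumberIs A 1 ⇔ DefensiveVertex
  allianceNumber≡1⇔ = mk⇔ to from
    where
    to : AllianceNumberIs A 1 → DefensiveVertex
    to ((S , da , |S|≡1) , _) with toSet-complete |S|≡1
    ... | x ∷ [] , unique , S≗ =
      x , subst (x DefendedBy_) (singleton-neighbours x) (Equivalence.to (alliance⇔defended S≗ unique) da (here refl))
    from : DefensiveVertex → AllianceNumberIs A 1
    from (x , x≤1) = toSet-allianceNumber ([] ∷ []) defended (alliance-size≥1 A)
      where
      defended : ∀ {v} → v ∈ x ∷ [] → v DefendedBy neighboursIn (x ∷ []) v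
      defended (here refl) = subst (x DefendedBy_) (sym (singleton-neighbours x)) x≤1

  pair⇒edge : ∀ {x y} → ¬ DefensiveVertex → x DefendedBy ⟦ A x y ⟧ → y DefendedBy ⟦ A x y ⟧ → DefensiveEdge
  pair⇒edge {x} {y} noVertex dx dy with A x y in xy
  ... | true  = x , y , xy , dx , dy
  ... | false = ⊥-elim (noVertex (x , dx))

  allianceNumber≡2⇔ : AllianceNumberIs A 2 ⇔ (¬ AllianceNumberIs A 1 × DefensiveEdge)
  allianceNumber≡2⇔ = mk⇔ to from
    where
    to : AllianceNumberIs A 2 → ¬ AllianceNumberIs A 1 × DefensiveEdge
    to a≡2@((S , da , |S|≡2) , _) with toSet-complete |S|≡2
    ... | x ∷ y ∷ [] , unique , S≗ = ¬a≡1 , pair⇒edge (¬a≡1 ∘ Equivalence.from allianceNumber≡1⇔) dx dy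
      where
      ¬a≡1 : ¬ AllianceNumberIs A 1
      ¬a≡1 = allianceNumber-≢ A a≡2 (λ ())
      defended : ∀ {v} → v ∈ x ∷ y ∷ [] → v DefendedBy neighboursIn (x ∷ y ∷ []) v
      defended = Equivalence.to (alliance⇔defended S≗ unique) da
      dx : x DefendedBy ⟦ A x y ⟧
      dx = subst (x DefendedBy_) (proj₁ (pair-neighbours x y)) (defended (here refl))
      dy : y DefendedBy ⟦ A x y ⟧
      dy = subst (y DefendedBy_) (proj₂ (pair-neighbours x y)) (defended (there (here refl)))
    from : ¬ AllianceNumberIs A 1 × DefensiveEdge → AllianceNumberIs A 2
    from (¬a≡1 , k , l , kl , k≤3 , l≤3) =
      toSet-allianceNumber ((E⇒≢ kl ∷ []) ∷ [] ∷ []) defended (alliance-size-step A (alliance-size≥1 A) ¬a≡1)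
      where
      defended : ∀ {v} → v ∈ k ∷ l ∷ [] → v DefendedBy neighboursIn (k ∷ l ∷ []) v
      defended (here refl) =
        subst (k DefendedBy_) (sym (proj₁ (pair-neighbours k l))) (subst (λ b → k DefendedBy ⟦ b ⟧) (sym kl) k≤3)
      defended (there (here refl)) =
        subst (l DefendedBy_) (sym (proj₂ (pair-neighbours k l))) (subst (λ b → l DefendedBy ⟦ b ⟧) (sym kl) l≤3)

  triad⇒shape : ∀ {x y z} → ¬ DefensiveVertex → x ≢ y → x ≢ z → y ≢ z →
                x DefendedBy (⟦ A x y ⟧ + ⟦ A x z ⟧) → y DefendedBy (⟦ A x y ⟧ + ⟦ A y z ⟧) →
                z DefendedBy (⟦ A x z ⟧ + ⟦ A y z ⟧) → DefensivePath ⊎ DefensiveTriangle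
  triad⇒shape {x} {y} {z} noVertex x≢y x≢z y≢z dx dy dz with A x y in xy | A x z in xz | A y z in yz
  ... | true  | true  | true  = inj₂ (x , y , z , xy , yz , xz , dx , dy , dz)
  ... | true  | true  | false = inj₁ (y , x , z , y≢z , trans (Graph.sym H y x) xy , xz , yz , dy , dx , dz)
  ... | true  | false | true  = inj₁ (x , y , z , x≢z , xy , yz , xz , dx , dy , dz)
  ... | false | true  | true  = inj₁ (x , z , y , x≢y , xz , trans (Graph.sym H z y) yz , xy , dx , dz , dy)
  ... | _     | false | false = ⊥-elim (noVertex (z , dz))
  ... | false | _     | false = ⊥-elim (noVertex (y , dy))
  ... | false | false | _     = ⊥-elim (noVertex (x , dx))

  triad-allianceNumber : ∀ {x y z} → Unique (x ∷ y ∷ z ∷ []) → ¬ AllianceNumberIs A 1 → ¬ AllianceNumberIs A 2 →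
                         x DefendedBy (⟦ A x y ⟧ + ⟦ A x z ⟧) → y DefendedBy (⟦ A x y ⟧ + ⟦ A y z ⟧) →
                         z DefendedBy (⟦ A x z ⟧ + ⟦ A y z ⟧) → AllianceNumberIs A 3
  triad-allianceNumber {x} {y} {z} unique ¬a≡1 ¬a≡2 dx dy dz =
    toSet-allianceNumber unique defended (alliance-size-step A (alliance-size-step A (alliance-size≥1 A) ¬a≡1) ¬a≡2)
    where
    neighbours = triad-neighbours x y z
    defended : ∀ {v} → v ∈ x ∷ y ∷ z ∷ [] → v DefendedBy neighboursIn (x ∷ y ∷ z ∷ []) v
    defended (here refl)                 = subst (x DefendedBy_) (sym (proj₁ neighbours)) dx
    defended (there (here refl))         = subst (y DefendedBy_) (sym (proj₁ (proj₂ neighbours))) dy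
    defended (there (there (here refl))) = subst (z DefendedBy_) (sym (proj₂ (proj₂ neighbours))) dz

  allianceNumber≡3⇔ : AllianceNumberIs A 3 ⇔
                      (¬ AllianceNumberIs A 1 × ¬ AllianceNumberIs A 2 × (DefensivePath ⊎ DefensiveTriangle))
  allianceNumber≡3⇔ = mk⇔ to from
    where
    to : AllianceNumberIs A 3 → ¬ AllianceNumberIs A 1 × ¬ AllianceNumberIs A 2 × (DefensivePath ⊎ DefensiveTriangle)
    to a≡3@((S , da , |S|≡3) , _) = ¬a≡1 , allianceNumber-≢ A a≡3 (λ ()) , shape (toSet-complete |S|≡3)
      where
      ¬a≡1 : ¬ AllianceNumberIs A 1
      ¬a≡1 = allianceNumber-≢ A a≡3 (λ ())
      shape : ∃[ xs ] (Unique xs × S ≗ toSet xs) → DefensivePath ⊎ DefensiveTriangle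
      shape (x ∷ y ∷ z ∷ [] , unique@((x≢y ∷ x≢z ∷ []) ∷ (y≢z ∷ []) ∷ [] ∷ []) , S≗) =
        triad⇒shape (¬a≡1 ∘ Equivalence.from allianceNumber≡1⇔) x≢y x≢z y≢z
          (bound (here refl) (proj₁ neighbours)) (bound (there (here refl)) (proj₁ (proj₂ neighbours)))
          (bound (there (there (here refl))) (proj₂ (proj₂ neighbours)))
        where
        neighbours = triad-neighbours x y z
        bound : ∀ {v s} → v ∈ x ∷ y ∷ z ∷ [] → neighboursIn (x ∷ y ∷ z ∷ []) v ≡ s → v DefendedBy s
        bound {v} v∈ eq = subst (v DefendedBy_) eq (Equivalence.to (alliance⇔defended S≗ unique) da v∈)
    from : ¬ AllianceNumberIs A 1 × ¬ AllianceNumberIs A 2 × (DefensivePath ⊎ DefensiveTriangle) → AllianceNumberIs A 3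
    from (¬a≡1 , ¬a≡2 , inj₁ (k , l , m , k≢m , kl , lm , km , k≤3 , l≤5 , m≤3)) =
      triad-allianceNumber ((E⇒≢ kl ∷ k≢m ∷ []) ∷ (E⇒≢ lm ∷ []) ∷ [] ∷ []) ¬a≡1 ¬a≡2
        (subst₂ (λ a b → k DefendedBy (⟦ a ⟧ + ⟦ b ⟧)) (sym kl) (sym km) k≤3)
        (subst₂ (λ a b → l DefendedBy (⟦ a ⟧ + ⟦ b ⟧)) (sym kl) (sym lm) l≤5)
        (subst₂ (λ a b → m DefendedBy (⟦ a ⟧ + ⟦ b ⟧)) (sym km) (sym lm) m≤3)
    from (¬a≡1 , ¬a≡2 , inj₂ (k , l , m , kl , lm , km , k≤5 , l≤5 , m≤5)) =
      triad-allianceNumber ((E⇒≢ kl ∷ E⇒≢ km ∷ []) ∷ (E⇒≢ lm ∷ []) ∷ [] ∷ []) ¬a≡1 ¬a≡2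
        (subst₂ (λ a b → k DefendedBy (⟦ a ⟧ + ⟦ b ⟧)) (sym kl) (sym km) k≤5)
        (subst₂ (λ a b → l DefendedBy (⟦ a ⟧ + ⟦ b ⟧)) (sym kl) (sym lm) l≤5)
        (subst₂ (λ a b → m DefendedBy (⟦ a ⟧ + ⟦ b ⟧)) (sym km) (sym lm) m≤5)

-- Line graphs

lookup-injective : ∀ {a} {A : Set a} {xs : List A} → ListUnique.Unique xs →
                   ∀ i j → List.lookup xs i ≡ List.lookup xs j → i ≡ j
lookup-injective (_ ∷ _)      zero    zero    _  = refl
lookup-injective (x∉xs ∷ _)   zero    (suc j) eq = ⊥-elim (ListAll.lookup x∉xs (∈-lookup j) eq)
lookup-injective (x∉xs ∷ _)   (suc i) zero    eq = ⊥-elim (ListAll.lookup x∉xs (∈-lookup i) (sym eq))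
lookup-injective (_ ∷ unique) (suc i) (suc j) eq = cong suc (lookup-injective unique i j eq)

degree-pairs≤3 : ∀ {p q} → 1 ≤ p → 1 ≤ q → p + q ≤ 3 → (p ≡ 1 × q ≡ 1) ⊎ (p ≡ 1 × q ≡ 2) ⊎ (p ≡ 2 × q ≡ 1)
degree-pairs≤3 {1} {1} _ _ _ = inj₁ (refl , refl)
degree-pairs≤3 {1} {2} _ _ _ = inj₂ (inj₁ (refl , refl))
degree-pairs≤3 {2} {1} _ _ _ = inj₂ (inj₂ (refl , refl))
degree-pairs≤3 {1} {suc (suc (suc _))} _ _ (s≤s (s≤s (s≤s ())))
degree-pairs≤3 {2} {suc (suc _)} _ _ (s≤s (s≤s (s≤s ())))
degree-pairs≤3 {suc (suc (suc p))} {suc q} _ _ (s≤s (s≤s (s≤s p+1+q≤0))) with () ← subst (_≤ 0) (+-suc p q) p+1+q≤0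

module _ (G : Graph) where
  private
    V = Fin (n G)
    Edge = Fin (nL G)

  isEdge : V × V → Bool
  isEdge e = ⌊ toℕ (proj₁ e) <? toℕ (proj₂ e) ⌋ ∧ adj G (proj₁ e) (proj₂ e)

  -- Written as a filter, the edge list inherits uniqueness and membership from the library.
  edges≡filter : edges G ≡ filter (T? ∘ isEdge) (cartesianProduct (allFin (n G)) (allFin (n G)))
  edges≡filter = rows (allFin (n G))
    where
    row : ∀ i ys → concatMap (λ j → if isEdge (i , j) then (i , j) List.∷ List.[] else List.[]) ys
                   ≡ filter (T? ∘ isEdge) (List.map (i ,_) ys)
    row i List.[] = refl
    row i (j List.∷ ys) with isEdge (i , j)
    ... | true  = cong ((i , j) List.∷_) (row i ys)
    ... | false = row i ys
    rows : ∀ xs → concatMap (λ i → concatMap (λ j → if isEdge (i , j) then (i , j) List.∷ List.[] else List.[])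
                                                (allFin (n G))) xs
                  ≡ filter (T? ∘ isEdge) (cartesianProduct xs (allFin (n G)))
    rows List.[]        = refl
    rows (i List.∷ xs) = trans (cong₂ _++_ (row i (allFin (n G))) (rows xs))
                                (sym (filter-++ (T? ∘ isEdge) (List.map (i ,_) (allFin (n G))) _))

  edges-unique : ListUnique.Unique (edges G)
  edges-unique = subst ListUnique.Unique (sym edges≡filter)
    (ListUnique.filter⁺ (T? ∘ isEdge) (ListUnique.cartesianProduct⁺ (ListUnique.allFin⁺ _) (ListUnique.allFin⁺ _)))

  edgeAt-isEdge : ∀ k → T (isEdge (edgeAt G k))
  edgeAt-isEdge k = proj₂ (∈-filter⁻ (T? ∘ isEdge) {xs = cartesianProduct (allFin (n G)) (allFin (n G))}
                                    (subst (edgeAt G k ∈ₗ_) edges≡filter (∈-lookup k)))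

  edgeAt-ordered : ∀ {k u v} → edgeAt G k ≡ (u , v) → toℕ u < toℕ v × E G u v
  edgeAt-ordered {k} {u} {v} k≡uv with Equivalence.to (T-∧ {⌊ toℕ u <? toℕ v ⌋}) (subst (T ∘ isEdge) k≡uv (edgeAt-isEdge k))
  ... | u<v , uv = toWitness u<v , Equivalence.to T-≡ uv

  edge-index : ∀ {u v} → toℕ u < toℕ v → E G u v → ∃[ k ] edgeAt G k ≡ (u , v)
  edge-index {u} {v} u<v uv = ListAny.index uv∈ , sym (lookup-index uv∈)
    where
    uv∈ : (u , v) ∈ₗ edges G
    uv∈ = subst ((u , v) ∈ₗ_) (sym edges≡filter)
      (∈-filter⁺ (T? ∘ isEdge) (∈-cartesianProduct⁺ (∈-allFin u) (∈-allFin v))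
        (Equivalence.from T-∧ (fromWitness u<v , Equivalence.from T-≡ uv)))

  Joins : Edge → V → V → Set
  Joins k u v = edgeAt G k ≡ (u , v) ⊎ edgeAt G k ≡ (v , u)

  joins-sym : ∀ {k u v} → Joins k u v → Joins k v u
  joins-sym = swap

  joins-edgeAt : ∀ k → Joins k (proj₁ (edgeAt G k)) (proj₂ (edgeAt G k))
  joins-edgeAt k = inj₁ refl

  joins-E : ∀ {k u v} → Joins k u v → E G u v
  joins-E (inj₁ k≡uv) = proj₂ (edgeAt-ordered k≡uv)
  joins-E (inj₂ k≡vu) = trans (Graph.sym G _ _) (proj₂ (edgeAt-ordered k≡vu))

  E⇒joins : ∀ {u v} → E G u v → ∃[ k ] Joins k u v
  E⇒joins {u} {v} uv with <-cmp (toℕ u) (toℕ v)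
  ... | tri< u<v _ _ = let k , k≡uv = edge-index u<v uv in k , inj₁ k≡uv
  ... | tri≈ _ u≡v _ = ⊥-elim (E⇒≢ G uv (toℕ-injective u≡v))
  ... | tri> _ _ v<u = let k , k≡vu = edge-index v<u (trans (Graph.sym G v u) uv) in k , inj₂ k≡vu

  joins-cases : ∀ {k a b s t} → Joins k a b → Joins k s t → (s ≡ a × t ≡ b) ⊎ (s ≡ b × t ≡ a)
  joins-cases (inj₁ k≡ab) (inj₁ k≡st) with trans (sym k≡ab) k≡st
  ... | refl = inj₁ (refl , refl)
  joins-cases (inj₁ k≡ab) (inj₂ k≡ts) with trans (sym k≡ab) k≡ts
  ... | refl = inj₂ (refl , refl)
  joins-cases (inj₂ k≡ba) (inj₁ k≡st) with trans (sym k≡ba) k≡st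
  ... | refl = inj₂ (refl , refl)
  joins-cases (inj₂ k≡ba) (inj₂ k≡ts) with trans (sym k≡ba) k≡ts
  ... | refl = inj₁ (refl , refl)

  endpoint : ∀ {k a b s t} → Joins k a b → Joins k s t → s ≡ a ⊎ s ≡ b
  endpoint k∋ab k∋st with joins-cases k∋ab k∋st
  ... | inj₁ (s≡a , _) = inj₁ s≡a
  ... | inj₂ (s≡b , _) = inj₂ s≡b

  joins-functional : ∀ {k a b c} → Joins k a b → Joins k a c → b ≡ c
  joins-functional k∋ab k∋ac with joins-cases k∋ab k∋ac
  ... | inj₁ (_ , c≡b)   = sym c≡b
  ... | inj₂ (a≡b , c≡a) = trans (sym a≡b) (sym c≡a)

  joins-injective : ∀ {k l u v} → Joins k u v → Joins l u v → k ≡ l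
  joins-injective (inj₁ k≡uv) (inj₁ l≡uv) = lookup-injective edges-unique _ _ (trans k≡uv (sym l≡uv))
  joins-injective (inj₂ k≡vu) (inj₂ l≡vu) = lookup-injective edges-unique _ _ (trans k≡vu (sym l≡vu))
  joins-injective (inj₁ k≡uv) (inj₂ l≡vu) = ⊥-elim (<-asym (proj₁ (edgeAt-ordered k≡uv)) (proj₁ (edgeAt-ordered l≡vu)))
  joins-injective (inj₂ k≡vu) (inj₁ l≡uv) = ⊥-elim (<-asym (proj₁ (edgeAt-ordered k≡vu)) (proj₁ (edgeAt-ordered l≡uv)))

  joins-≢ : ∀ {k l v u w} → Joins k v u → Joins l v w → u ≢ w → k ≢ l
  joins-≢ k∋vu l∋vw u≢w refl = u≢w (joins-functional k∋vu l∋vw)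

  joins-≢⁻ : ∀ {k l v u w} → Joins k v u → Joins l v w → k ≢ l → u ≢ w
  joins-≢⁻ k∋vu l∋vw k≢l u≡w = k≢l (joins-injective k∋vu (subst (Joins _ _) (sym u≡w) l∋vw))

  incident : V → Edge → Bool
  incident x l = ⁅ x ⁆ (proj₁ (edgeAt G l)) ∨ ⁅ x ⁆ (proj₂ (edgeAt G l))

  incident⁺ : ∀ {l x y} → Joins l x y → incident x l ≡ true
  incident⁺ {x = x} {y} (inj₁ l≡xy) =
    subst (λ e → ⁅ x ⁆ (proj₁ e) ∨ ⁅ x ⁆ (proj₂ e) ≡ true) (sym l≡xy) (cong (_∨ ⁅ x ⁆ y) (⁅⁆-refl x))
  incident⁺ {x = x} {y} (inj₂ l≡yx) =
    subst (λ e → ⁅ x ⁆ (proj₁ e) ∨ ⁅ x ⁆ (proj₂ e) ≡ true) (sym l≡yx)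
      (trans (cong (⁅ x ⁆ y ∨_) (⁅⁆-refl x)) (∨-zeroʳ _))

  incident⁻ : ∀ {l x} → incident x l ≡ true → ∃[ y ] Joins l x y
  incident⁻ {l} {x} x∈l with ∨-true⁻ {⁅ x ⁆ (proj₁ (edgeAt G l))} x∈l
  ... | inj₁ x≡a = _ , subst (λ v → Joins l v (proj₂ (edgeAt G l))) (sym (⁅⁆-true⁻ x≡a)) (joins-edgeAt l)
  ... | inj₂ x≡b = _ , subst (λ v → Joins l v (proj₁ (edgeAt G l))) (sym (⁅⁆-true⁻ x≡b)) (joins-sym (joins-edgeAt l))

  lineAdj≡ : ∀ k l → lineAdj G k l ≡ not (⁅ k ⁆ l) ∧ (incident (proj₁ (edgeAt G k)) l ∨ incident (proj₂ (edgeAt G k)) l)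
  lineAdj≡ k l with edgeAt G k | edgeAt G l
  ... | a , b | c , d = cong (not (⁅ k ⁆ l) ∧_) (sym (∨-assoc (⁅ a ⁆ c) (⁅ a ⁆ d) (⁅ b ⁆ c ∨ ⁅ b ⁆ d)))

  lineAdj-intro : ∀ {k l x y z} → k ≢ l → Joins k x y → Joins l x z → lineAdj G k l ≡ true
  lineAdj-intro {k} {l} {x} {y} k≢l k∋xy l∋xz = trans (lineAdj≡ k l) (cong₂ (λ a b → not a ∧ b) (⁅⁆-false k≢l) shared)
    where
    shared : incident (proj₁ (edgeAt G k)) l ∨ incident (proj₂ (edgeAt G k)) l ≡ true
    shared with endpoint (joins-edgeAt k) k∋xy
    ... | inj₁ x≡a rewrite sym x≡a = cong (_∨ incident (proj₂ (edgeAt G k)) l) (incident⁺ l∋xz)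
    ... | inj₂ x≡b rewrite sym x≡b = trans (cong (incident (proj₁ (edgeAt G k)) l ∨_) (incident⁺ l∋xz)) (∨-zeroʳ _)

  lineAdj-elim : ∀ {k l} → lineAdj G k l ≡ true → k ≢ l × ∃[ x ] ∃[ y ] ∃[ z ] (Joins k x y × Joins l x z)
  lineAdj-elim {k} {l} kl with ∧-true⁻ (trans (sym (lineAdj≡ k l)) kl)
  ... | k≠ᵇl , shared = distinct , common (∨-true⁻ shared)
    where
    distinct : k ≢ l
    distinct refl with () ← trans (sym (cong not (⁅⁆-refl k))) k≠ᵇl
    common : incident (proj₁ (edgeAt G k)) l ≡ true ⊎ incident (proj₂ (edgeAt G k)) l ≡ true →
             ∃[ x ] ∃[ y ] ∃[ z ] (Joins k x y × Joins l x z)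
    common (inj₁ a∈l) = let z , l∋az = incident⁻ a∈l in _ , _ , z , joins-edgeAt k , l∋az
    common (inj₂ b∈l) = let z , l∋bz = incident⁻ b∈l in _ , _ , z , joins-sym (joins-edgeAt k) , l∋bz

  lineAdj-at : ∀ {k l v u w} → Joins k v u → Joins l v w → u ≢ w → lineAdj G k l ≡ true
  lineAdj-at k∋vu l∋vw u≢w = lineAdj-intro (joins-≢ k∋vu l∋vw u≢w) k∋vu l∋vw

  lineAdj-flip : ∀ {k l} → lineAdj G k l ≡ true → lineAdj G l k ≡ true
  lineAdj-flip kl with lineAdj-elim kl
  ... | k≢l , _ , _ , _ , k∋xy , l∋xz = lineAdj-intro (k≢l ∘ sym) l∋xz k∋xy

  lineAdj-sym : ∀ k l → lineAdj G k l ≡ lineAdj G l k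
  lineAdj-sym k l with lineAdj G k l in kl | lineAdj G l k in lk
  ... | true  | true  = refl
  ... | false | false = refl
  ... | true  | false = trans (sym (lineAdj-flip kl)) lk
  ... | false | true  = trans (sym kl) (lineAdj-flip lk)

  lineAdj-irrefl : ∀ k → lineAdj G k k ≡ false
  lineAdj-irrefl k = trans (lineAdj≡ k k) (cong (λ b → not b ∧ (incident (proj₁ (edgeAt G k)) k ∨ incident (proj₂ (edgeAt G k)) k)) (⁅⁆-refl k))

  lineGraph : Graph
  lineGraph = record { n = nL G ; adj = lineAdj G ; sym = lineAdj-sym ; irrefl = lineAdj-irrefl }

  count-incident : ∀ x → count (incident x) ≡ deg G x
  count-incident x = ≤-antisym
    (count-≤-injection {p = incident x} {q = adj G x} (λ l x∈l → proj₁ (incident⁻ {l} {x} x∈l))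
      (λ l x∈l → joins-E (proj₂ (incident⁻ {l} {x} x∈l)))
      (λ l l′ x∈l x∈l′ same → joins-injective (proj₂ (incident⁻ {l} {x} x∈l))
                                (subst (Joins l′ x) (sym same) (proj₂ (incident⁻ {l′} {x} x∈l′)))))
    (count-≤-injection {p = adj G x} {q = incident x} (λ y xy → proj₁ (E⇒joins xy)) (λ y xy → incident⁺ (proj₂ (E⇒joins xy)))
      (λ y y′ xy xy′ same → joins-functional (proj₂ (E⇒joins xy))
                              (subst (λ k → Joins k x y′) (sym same) (proj₂ (E⇒joins xy′)))))

  -- The edges at a or b other than k are the neighbours of k, and k is the only edge at both.
  lineDegree-edgeAt : ∀ k → deg lineGraph k + 2 ≡ deg G (proj₁ (edgeAt G k)) + deg G (proj₂ (edgeAt G k))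
  lineDegree-edgeAt k = begin
    count (lineAdj G k) + 2                                            ≡⟨ +-suc _ 1 ⟩
    suc (count (lineAdj G k)) + 1                                      ≡⟨ cong (_+ 1) |a∪b|≡ ⟨
    count (incident a ∪ incident b) + 1                                ≡⟨ cong (count (incident a ∪ incident b) +_) |a∩b|≡1 ⟨
    count (incident a ∪ incident b) + count (incident a ∩ incident b)  ≡⟨ count-∪-∩ (incident a) (incident b) ⟩
    count (incident a) + count (incident b)                            ≡⟨ cong₂ _+_ (count-incident a) (count-incident b) ⟩
    deg G a + deg G b                                                  ∎
    where
    open ≡-Reasoning
    a = proj₁ (edgeAt G k)
    b = proj₂ (edgeAt G k)
    |a∪b|≡ : count (incident a ∪ incident b) ≡ suc (count (lineAdj G k))
    |a∪b|≡ = trans (count-remove {p = incident a ∪ incident b} (cong (_∨ incident b k) (incident⁺ (joins-edgeAt k))))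
                   (cong suc (count-cong (λ l → trans (∧-comm (incident a l ∨ incident b l) _) (sym (lineAdj≡ k l)))))
    only-k : ∀ l → (incident a ∩ incident b) l ≡ true → l ≡ k
    only-k l a,b∈l with ∧-true⁻ a,b∈l
    ... | a∈l , b∈l with incident⁻ a∈l | incident⁻ b∈l
    ... | y , l∋ay | z , l∋bz with joins-cases l∋ay l∋bz
    ...   | inj₁ (b≡a , _) = ⊥-elim (E⇒≢ G (joins-E (joins-edgeAt k)) (sym b≡a))
    ...   | inj₂ (b≡y , _) = joins-injective (subst (Joins l a) (sym b≡y) l∋ay) (joins-edgeAt k)
    |a∩b|≡1 : count (incident a ∩ incident b) ≡ 1
    |a∩b|≡1 = count-singleton (cong₂ _∧_ (incident⁺ (joins-edgeAt k)) (incident⁺ (joins-sym (joins-edgeAt k)))) only-k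

  lineDegree : ∀ {k u v} → Joins k u v → deg lineGraph k + 2 ≡ deg G u + deg G v
  lineDegree {k} k∋uv with joins-cases (joins-edgeAt k) k∋uv
  ... | inj₁ (refl , refl) = lineDegree-edgeAt k
  ... | inj₂ (refl , refl) = trans (lineDegree-edgeAt k) (+-comm (deg G (proj₁ (edgeAt G k))) _)

  lineDegree-≤ : ∀ {k u v c} → Joins k u v → deg G u + deg G v ≤ c + 2 → deg lineGraph k ≤ c
  lineDegree-≤ {k} {c = c} k∋uv ≤c+2 = +-cancelʳ-≤ 2 _ c (subst (_≤ c + 2) (sym (lineDegree k∋uv)) ≤c+2)

  lineDegree-≤⁻ : ∀ {k u v c} → Joins k u v → deg lineGraph k ≤ c → deg G u + deg G v ≤ c + 2
  lineDegree-≤⁻ {c = c} k∋uv ≤c = subst (_≤ c + 2) (lineDegree k∋uv) (+-monoˡ-≤ 2 ≤c)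

  BoundedP₃ : Set
  BoundedP₃ = ∃[ u ] ∃[ v ] ∃[ w ] (u ≢ w × E G u v × E G v w
                × deg G u + deg G v ≤ 5 × deg G v + deg G w ≤ 5)

  BoundedP₄ : Set
  BoundedP₄ = ∃[ u ] ∃[ v ] ∃[ w ] ∃[ x ] (u ≢ w × u ≢ x × v ≢ x × E G u v × E G v w × E G w x
                × deg G u + deg G v ≤ 5 × deg G x + deg G w ≤ 5 × deg G v + deg G w ≤ 7)

  BoundedK₃ : Set
  BoundedK₃ = ∃[ u ] ∃[ v ] ∃[ w ] (E G u v × E G u w × E G v w
                × deg G u + deg G v ≤ 7 × deg G u + deg G w ≤ 7 × deg G v + deg G w ≤ 7)

  BoundedK₁₃ : Set
  BoundedK₁₃ = ∃[ u ] ∃[ v ] ∃[ w ] ∃[ x ] (u ≢ w × u ≢ x × w ≢ x × E G v u × E G v w × E G v x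
                 × deg G v + deg G u ≤ 7 × deg G v + deg G w ≤ 7 × deg G v + deg G x ≤ 7)

  K₂⊎pendant⇔DefensiveVertex : (HasK2Component G ⊎ DegOneNextToDegTwo G) ⇔ DefensiveVertex lineGraph
  K₂⊎pendant⇔DefensiveVertex = mk⇔ to from
    where
    to : HasK2Component G ⊎ DegOneNextToDegTwo G → DefensiveVertex lineGraph
    to (inj₁ (u , v , uv , u≡1 , v≡1)) =
      let k , k∋uv = E⇒joins uv in k , lineDegree-≤ k∋uv (≤-trans (≤-reflexive (cong₂ _+_ u≡1 v≡1)) (s≤s (s≤s z≤n)))
    to (inj₂ (u , v , uv , u≡1 , v≡2)) =
      let k , k∋uv = E⇒joins uv in k , lineDegree-≤ k∋uv (≤-reflexive (cong₂ _+_ u≡1 v≡2))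
    from : DefensiveVertex lineGraph → HasK2Component G ⊎ DegOneNextToDegTwo G
    from (k , k≤1) with degree-pairs≤3 (E⇒1≤deg G ab) (E⇒1≤deg G (joins-E (joins-sym (joins-edgeAt k))))
                                       (lineDegree-≤⁻ (joins-edgeAt k) k≤1)
      where
      ab = joins-E (joins-edgeAt k)
    ... | inj₁ (a≡1 , b≡1)        = inj₁ (_ , _ , joins-E (joins-edgeAt k) , a≡1 , b≡1)
    ... | inj₂ (inj₁ (a≡1 , b≡2)) = inj₂ (_ , _ , joins-E (joins-edgeAt k) , a≡1 , b≡2)
    ... | inj₂ (inj₂ (a≡2 , b≡1)) = inj₂ (_ , _ , joins-E (joins-sym (joins-edgeAt k)) , b≡1 , a≡2)

  BoundedP₃⇔DefensiveEdge : BoundedP₃ ⇔ DefensiveEdge lineGraph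
  BoundedP₃⇔DefensiveEdge = mk⇔ to from
    where
    to : BoundedP₃ → DefensiveEdge lineGraph
    to (u , v , w , u≢w , uv , vw , uv≤5 , vw≤5) =
      let k , k∋uv = E⇒joins uv
          l , l∋vw = E⇒joins vw
      in k , l , lineAdj-at (joins-sym k∋uv) l∋vw u≢w , lineDegree-≤ k∋uv uv≤5 , lineDegree-≤ l∋vw vw≤5
    from : DefensiveEdge lineGraph → BoundedP₃
    from (k , l , kl , k≤3 , l≤3) =
      let k≢l , x , y , z , k∋xy , l∋xz = lineAdj-elim kl
      in y , x , z , joins-≢⁻ k∋xy l∋xz k≢l , joins-E (joins-sym k∋xy) , joins-E l∋xz ,
         lineDegree-≤⁻ (joins-sym k∋xy) k≤3 , lineDegree-≤⁻ l∋xz l≤3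

  BoundedP₄⇔DefensivePath : BoundedP₄ ⇔ DefensivePath lineGraph
  BoundedP₄⇔DefensivePath = mk⇔ to from
    where
    to : BoundedP₄ → DefensivePath lineGraph
    to (u , v , w , x , u≢w , u≢x , v≢x , uv , vw , wx , uv≤5 , xw≤5 , vw≤7) =
      k , l , m , k≢m , lineAdj-at (joins-sym k∋uv) l∋vw u≢w , lineAdj-at (joins-sym l∋vw) m∋wx v≢x ,
      ¬-not k≁m , lineDegree-≤ k∋uv uv≤5 , lineDegree-≤ l∋vw vw≤7 , lineDegree-≤ (joins-sym m∋wx) xw≤5
      where
      k = proj₁ (E⇒joins uv)
      k∋uv = proj₂ (E⇒joins uv)
      l = proj₁ (E⇒joins vw)
      l∋vw = proj₂ (E⇒joins vw)
      m = proj₁ (E⇒joins wx)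
      m∋wx = proj₂ (E⇒joins wx)
      k≢m : k ≢ m
      k≢m k≡m with joins-cases k∋uv (subst (λ e → Joins e w x) (sym k≡m) m∋wx)
      ... | inj₁ (w≡u , _) = u≢w (sym w≡u)
      ... | inj₂ (_ , x≡u) = u≢x (sym x≡u)
      k≁m : lineAdj G k m ≢ true
      k≁m km with lineAdj-elim km
      ... | _ , s , _ , _ , k∋s , m∋s with endpoint k∋uv k∋s | endpoint m∋wx m∋s
      ...   | inj₁ refl | inj₁ u≡w = u≢w u≡w
      ...   | inj₁ refl | inj₂ u≡x = u≢x u≡x
      ...   | inj₂ refl | inj₁ v≡w = E⇒≢ G vw v≡w
      ...   | inj₂ refl | inj₂ v≡x = v≢x v≡x
    -- l meets k and m in different endpoints, as k and m are not adjacent.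
    from : DefensivePath lineGraph → BoundedP₄
    from (k , l , m , k≢m , kl , lm , km , k≤3 , l≤5 , m≤3) with lineAdj-elim kl | lineAdj-elim lm
    ... | k≢l , x , y , z , k∋xy , l∋xz | l≢m , p , q , r , l∋pq , m∋pr with joins-cases l∋xz l∋pq
    ...   | inj₁ (refl , refl) with () ← trans (sym (lineAdj-intro k≢m k∋xy m∋pr)) km
    ...   | inj₂ (refl , refl) =
      y , x , z , r , joins-≢⁻ k∋xy l∋xz k≢l , y≢r , x≢r ,
      joins-E (joins-sym k∋xy) , joins-E l∋xz , joins-E m∋pr ,
      lineDegree-≤⁻ (joins-sym k∋xy) k≤3 , lineDegree-≤⁻ (joins-sym m∋pr) m≤3 , lineDegree-≤⁻ l∋xz l≤5
      where
      y≢r : y ≢ r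
      y≢r refl with () ← trans (sym (lineAdj-intro k≢m (joins-sym k∋xy) (joins-sym m∋pr))) km
      x≢r : x ≢ r
      x≢r refl = l≢m (joins-injective l∋xz (joins-sym m∋pr))

  BoundedK₃⊎K₁₃⇔DefensiveTriangle : (BoundedK₃ ⊎ BoundedK₁₃) ⇔ DefensiveTriangle lineGraph
  BoundedK₃⊎K₁₃⇔DefensiveTriangle = mk⇔ to from
    where
    to : BoundedK₃ ⊎ BoundedK₁₃ → DefensiveTriangle lineGraph
    to (inj₁ (u , v , w , uv , uw , vw , uv≤7 , uw≤7 , vw≤7)) =
      let k , k∋uv = E⇒joins uv
          l , l∋uw = E⇒joins uw
          m , m∋vw = E⇒joins vw
      in k , l , m , lineAdj-at k∋uv l∋uw (E⇒≢ G vw) , lineAdj-at (joins-sym l∋uw) (joins-sym m∋vw) (E⇒≢ G uv) ,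
         lineAdj-at (joins-sym k∋uv) m∋vw (E⇒≢ G uw) ,
         lineDegree-≤ k∋uv uv≤7 , lineDegree-≤ l∋uw uw≤7 , lineDegree-≤ m∋vw vw≤7
    to (inj₂ (u , v , w , x , u≢w , u≢x , w≢x , vu , vw , vx , vu≤7 , vw≤7 , vx≤7)) =
      let k , k∋vu = E⇒joins vu
          l , l∋vw = E⇒joins vw
          m , m∋vx = E⇒joins vx
      in k , l , m , lineAdj-at k∋vu l∋vw u≢w , lineAdj-at l∋vw m∋vx w≢x , lineAdj-at k∋vu m∋vx u≢x ,
         lineDegree-≤ k∋vu vu≤7 , lineDegree-≤ l∋vw vw≤7 , lineDegree-≤ m∋vx vx≤7
    -- Three pairwise adjacent edges either share an endpoint or form a triangle.
    from : DefensiveTriangle lineGraph → BoundedK₃ ⊎ BoundedK₁₃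
    from (k , l , m , kl , lm , km , k≤5 , l≤5 , m≤5) with lineAdj-elim kl | lineAdj-elim lm | lineAdj-elim km
    ... | k≢l , x , y , z , k∋xy , l∋xz | l≢m , p , q , r , l∋pq , m∋pr | k≢m , s , _ , _ , k∋s , m∋s
      with joins-cases l∋xz l∋pq
    ...   | inj₁ (refl , refl) =
      inj₂ (y , x , z , r , joins-≢⁻ k∋xy l∋xz k≢l , joins-≢⁻ k∋xy m∋pr k≢m , joins-≢⁻ l∋xz m∋pr l≢m ,
            joins-E k∋xy , joins-E l∋xz , joins-E m∋pr ,
            lineDegree-≤⁻ k∋xy k≤5 , lineDegree-≤⁻ l∋xz l≤5 , lineDegree-≤⁻ m∋pr m≤5)
    ...   | inj₂ (refl , refl) with endpoint k∋xy k∋s | endpoint m∋pr m∋s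
    ...     | inj₁ refl | inj₁ x≡z  = ⊥-elim (E⇒≢ G (joins-E l∋xz) x≡z)
    ...     | inj₁ refl | inj₂ refl = ⊥-elim (l≢m (joins-injective l∋xz (joins-sym m∋pr)))
    ...     | inj₂ refl | inj₁ y≡z  = ⊥-elim (joins-≢⁻ k∋xy l∋xz k≢l y≡z)
    ...     | inj₂ refl | inj₂ refl =
      inj₁ (x , y , z , joins-E k∋xy , joins-E l∋xz , joins-E (joins-sym m∋pr) ,
            lineDegree-≤⁻ k∋xy k≤5 , lineDegree-≤⁻ l∋xz l≤5 , lineDegree-≤⁻ (joins-sym m∋pr) m≤5)

mainTheorem4 : (G : Graph) →
    (aL≡ G 1 ⇔ (HasK2Component G ⊎ DegOneNextToDegTwo G))
    × (aL≡ G 2 ⇔ (¬ aL≡ G 1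
         × ∃[ u ] ∃[ v ] ∃[ w ] (¬ u ≡ w × E G u v × E G v w
             × deg G u + deg G v ≤ 5 × deg G v + deg G w ≤ 5)))
    × (aL≡ G 3 ⇔ (¬ aL≡ G 1 × ¬ aL≡ G 2
         × ((∃[ u ] ∃[ v ] ∃[ w ] ∃[ x ]
               (¬ u ≡ w × ¬ u ≡ x × ¬ v ≡ x
                 × E G u v × E G v w × E G w x
                 × deg G u + deg G v ≤ 5 × deg G x + deg G w ≤ 5
                 × deg G v + deg G w ≤ 7))
           ⊎ (∃[ u ] ∃[ v ] ∃[ w ]
               (E G u v × E G u w × E G v w
                 × deg G u + deg G v ≤ 7 × deg G u + deg G w ≤ 7
                 × deg G v + deg G w ≤ 7))
           ⊎ (∃[ u ] ∃[ v ] ∃[ w ] ∃[ x ]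
               (¬ u ≡ w × ¬ u ≡ x × ¬ w ≡ x
                 × E G v u × E G v w × E G v x
                 × deg G v + deg G u ≤ 7 × deg G v + deg G w ≤ 7
                 × deg G v + deg G x ≤ 7)))))
mainTheorem4 G =
    ⇔.trans (allianceNumber≡1⇔ L) (⇔.sym (K₂⊎pendant⇔DefensiveVertex G))
  , ⇔.trans (allianceNumber≡2⇔ L) (⇔.refl ×-⇔ ⇔.sym (BoundedP₃⇔DefensiveEdge G))
  , ⇔.trans (allianceNumber≡3⇔ L)
      (⇔.refl ×-⇔ ⇔.refl ×-⇔ ⇔.sym (BoundedP₄⇔DefensivePath G ⊎-⇔ BoundedK₃⊎K₁₃⇔DefensiveTriangle G))
  where
  L = lineGraph G
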